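{- Let $n$ be a positive integer and let $K$ be a field whose characteristic does not divide $n$ and which contains all $n$-th roots of unity. Let $a \in K^\times$ be an $n$-th power of an element of $K^\times$. Let $f(w) \in K[w]$ be a polynomial coprime to $1 - a w^n$. Consider the partial fraction decomposition \[ \frac{1}{(1 - a w^n) f(w)} = \frac{A(w)}{1 - a w^n} + \frac{B(w)}{f(w)} \] with $A(w), B(w) \in K[w]$, $\deg A(w) < n$ and $\deg B(w) < \deg f(w)$. Then \[ A(0) = \frac{1}{n} \sum_{\substack{\alpha \in K \\ \alpha^n = a}} \frac{1}{f(\alpha^{ -1})}. \]
   Context: The right-hand side, denoted $S_{f,a}(n)$ in the paper, is called a generalized Dedekind sum; it is well defined since $f(\alpha^{ -1}) \neq 0$ whenever $\alpha^n = a$. -}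

module Defs where

open import Level using (Level; _⊔_) renaming (suc to lsuc)
open import Algebra.Bundles using (CommutativeRing)
open import Data.Nat using (ℕ; zero; suc; _≤_; _<_)
open import Data.List using (List; []; _∷_; map; foldr; replicate; _++_; length)
open import Data.List.Relation.Unary.Any using (Any)
open import Data.List.Relation.Unary.All using (All)
open import Data.List.Relation.Unary.AllPairs using (AllPairs)
open import Data.Product using (Σ; _×_; ∃)
open import Relation.Nullary using (¬_)

-- A field: a commutative ring with 0 ≠ 1 in which every nonzero element
-- has a multiplicative inverse.  The inverse is a total operation whose
-- value at 0# is unspecified (the usual convention).
record Field (c ℓ : Level) : Set (lsuc (c ⊔ ℓ)) where
  field
    commutativeRing : CommutativeRing c ℓ
  open CommutativeRing commutativeRing public
  field
    _⁻¹         : Carrier → Carrier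
    0#≉1#       : ¬ (0# ≈ 1#)
    ⁻¹-inverseʳ : ∀ x → ¬ (x ≈ 0#) → x * (x ⁻¹) ≈ 1#

module FieldTheory {c ℓ : Level} (F : Field c ℓ) where
  open Field F

  infixr 8 _^_
  _^_ : Carrier → ℕ → Carrier
  x ^ zero  = 1#
  x ^ suc k = x * (x ^ k)

  ι : ℕ → Carrier
  ι zero    = 0#
  ι (suc k) = 1# + ι k

  CharNotDividing : ℕ → Set ℓ
  CharNotDividing n = ¬ (ι n ≈ 0#)

  -- "K contains all n-th roots of unity": there are n pairwise distinct
  -- n-th roots of unity in K (i.e. X^n - 1 splits into distinct linear factors)
  ContainsRootsOfUnity : ℕ → Set (c ⊔ ℓ)
  ContainsRootsOfUnity n =
    Σ (List Carrier) λ ζs →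
      (length ζs ≡ℕ n) × AllPairs (λ x y → ¬ (x ≈ y)) ζs × All (λ ζ → ζ ^ n ≈ 1#) ζs
    where open import Relation.Binary.PropositionalEquality using () renaming (_≡_ to _≡ℕ_)

  sumK : List Carrier → Carrier
  sumK = foldr _+_ 0#

  -- Polynomials in K[w], as coefficient lists (constant term first).
  -- Trailing zeros are allowed; equality is coefficientwise.
  Poly : Set c
  Poly = List Carrier

  coeff : Poly → ℕ → Carrier
  coeff []       _       = 0#
  coeff (x ∷ p)  zero    = x
  coeff (x ∷ p)  (suc k) = coeff p k

  infix 4 _≈ₚ_
  _≈ₚ_ : Poly → Poly → Set ℓ
  p ≈ₚ q = ∀ k → coeff p k ≈ coeff q k

  infixl 6 _+ₚ_
  _+ₚ_ : Poly → Poly → Poly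
  []      +ₚ q       = q
  (x ∷ p) +ₚ []      = x ∷ p
  (x ∷ p) +ₚ (y ∷ q) = (x + y) ∷ (p +ₚ q)

  infixl 7 _*ₚ_
  _*ₚ_ : Poly → Poly → Poly
  []      *ₚ q = []
  (x ∷ p) *ₚ q = map (x *_) q +ₚ (0# ∷ (p *ₚ q))

  constₚ : Carrier → Poly
  constₚ x = x ∷ []

  eval : Poly → Carrier → Carrier
  eval []      x = 0#
  eval (a ∷ p) x = a + x * eval p x

  oneMinus : Carrier → ℕ → Poly
  oneMinus a n = constₚ 1# +ₚ (replicate n 0# ++ (- a ∷ []))

  infix 4 _∣ₚ_
  _∣ₚ_ : Poly → Poly → Set (c ⊔ ℓ)
  d ∣ₚ p = Σ Poly λ r → r *ₚ d ≈ₚ p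

  Coprime : Poly → Poly → Set (c ⊔ ℓ)
  Coprime p q = ∀ d → d ∣ₚ p → d ∣ₚ q → d ∣ₚ constₚ 1#

  DegLessThan : Poly → ℕ → Set ℓ
  DegLessThan p n = ∀ j → n ≤ j → coeff p j ≈ 0#

  HasDegree : Poly → ℕ → Set ℓ
  HasDegree p d = ¬ (coeff p d ≈ 0#) × (∀ j → d < j → coeff p j ≈ 0#)

  -- deg p < deg q   (with deg 0 = -∞; only meaningful for q ≠ 0)
  DegLess : Poly → Poly → Set ℓ
  DegLess p q = ∀ d → HasDegree q d → DegLessThan p d

-- At a root y of 1 - a wⁿ the decomposition gives A(y) f(y) = 1, and these roots are the
-- reciprocals α⁻¹ of the solutions of αⁿ = a, i.e. the n solutions of yⁿ = a⁻¹.  So the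
-- claim is that the mean of A over the n-th roots of γ = a⁻¹ is A(0) whenever deg A < n.
-- By Lagrange interpolation at those roots, whose basis polynomial at β is
-- β (wⁿ - βⁿ) / ((w - β) n γ), the polynomial n γ A equals Σ_β β A(β) (wⁿ - βⁿ)/(w - β);
-- comparing constant terms gives n γ A(0) = Σ_β β A(β) βⁿ⁻¹ = γ Σ_β A(β).
module Submission where

open import Defs
open import Level using (Level; _⊔_)
open import Data.Nat using (ℕ; NonZero; zero; suc; z≤n; s≤s)
open import Data.Nat.Properties using (≤-trans)
open import Data.List using (List; []; _∷_; map; foldr; replicate; _++_; length)
open import Data.List.Properties using (length-map; map-∘)
open import Data.List.Relation.Unary.Any using (Any; here; there)
import Data.List.Relation.Unary.Any as Any
import Data.List.Relation.Unary.Any.Properties as AnyP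
open import Data.List.Relation.Unary.All using (All; []; _∷_)
import Data.List.Relation.Unary.All as All
import Data.List.Relation.Unary.All.Properties as AllP
open import Data.List.Relation.Unary.AllPairs using (AllPairs; []; _∷_)
import Data.List.Relation.Unary.AllPairs as AllPairs
import Data.List.Relation.Unary.AllPairs.Properties as AllPairsP
open import Data.Product using (Σ; _×_; _,_; proj₁; proj₂)
open import Data.Maybe using (nothing)
open import Function using (_∘_)
open import Relation.Nullary using (¬_)
open import Relation.Binary.PropositionalEquality using (_≡_)
import Relation.Binary.PropositionalEquality as ≡
open import Tactic.RingSolver.Core.AlmostCommutativeRing using (fromCommutativeRing)

module FieldProperties {c ℓ : Level} (K : Field c ℓ) where
  open Field K
  open FieldTheory K
  open import Algebra.Properties.Ring ring using ([y-z]x≈yx-zx; x∙y⁻¹≈ε⇒x≈y)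
  open import Algebra.Properties.CommutativeSemigroup *-commutativeSemigroup using (interchange)
  open import Relation.Binary.Reasoning.Setoid setoid

  ⁻¹-inverseˡ : ∀ x → x ≉ 0# → x ⁻¹ * x ≈ 1#
  ⁻¹-inverseˡ x x≉0 = trans (*-comm _ _) (⁻¹-inverseʳ x x≉0)

  *-cancelʳ-nonZero : ∀ {u v w} → w ≉ 0# → u * w ≈ v * w → u ≈ v
  *-cancelʳ-nonZero {u} {v} {w} w≉0 uw≈vw = begin
    u              ≈⟨ *-identityʳ u ⟨
    u * 1#         ≈⟨ *-congˡ (⁻¹-inverseʳ w w≉0) ⟨
    u * (w * w ⁻¹) ≈⟨ *-assoc u w _ ⟨
    u * w * w ⁻¹   ≈⟨ *-congʳ uw≈vw ⟩
    v * w * w ⁻¹   ≈⟨ *-assoc v w _ ⟩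
    v * (w * w ⁻¹) ≈⟨ *-congˡ (⁻¹-inverseʳ w w≉0) ⟩
    v * 1#         ≈⟨ *-identityʳ v ⟩
    v              ∎

  *-cancelˡ-nonZero : ∀ {w u v} → w ≉ 0# → w * u ≈ w * v → u ≈ v
  *-cancelˡ-nonZero {w} {u} {v} w≉0 wu≈wv =
    *-cancelʳ-nonZero w≉0 (trans (*-comm u w) (trans wu≈wv (*-comm w v)))

  *-nonZero : ∀ {x y} → x ≉ 0# → y ≉ 0# → x * y ≉ 0#
  *-nonZero {x} {y} x≉0 y≉0 xy≈0 =
    y≉0 (*-cancelˡ-nonZero x≉0 (trans xy≈0 (sym (zeroʳ x))))

  uq≈vq∧u≉v⇒q≈0 : ∀ {u v q} → u * q ≈ v * q → u ≉ v → q ≈ 0#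
  uq≈vq∧u≉v⇒q≈0 {u} {v} {q} uq≈vq u≉v = *-cancelˡ-nonZero (u≉v ∘ x∙y⁻¹≈ε⇒x≈y u v) (begin
    (u - v) * q   ≈⟨ [y-z]x≈yx-zx q u v ⟩
    u * q - v * q ≈⟨ +-congʳ uq≈vq ⟩
    v * q - v * q ≈⟨ -‿inverseʳ (v * q) ⟩
    0#            ≈⟨ zeroʳ (u - v) ⟨
    (u - v) * 0#  ∎)

  ⁻¹-unique : ∀ {x u} → x ≉ 0# → u * x ≈ 1# → u ≈ x ⁻¹
  ⁻¹-unique {x} x≉0 ux≈1 = *-cancelʳ-nonZero x≉0 (trans ux≈1 (sym (⁻¹-inverseˡ x x≉0)))

  ⁻¹-nonZero : ∀ {x} → x ≉ 0# → x ⁻¹ ≉ 0#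
  ⁻¹-nonZero {x} x≉0 x⁻¹≈0 =
    0#≉1# (trans (sym (zeroʳ x)) (trans (*-congˡ (sym x⁻¹≈0)) (⁻¹-inverseʳ x x≉0)))

  ⁻¹-cong : ∀ {x y} → x ≉ 0# → x ≈ y → x ⁻¹ ≈ y ⁻¹
  ⁻¹-cong {x} x≉0 x≈y =
    ⁻¹-unique (λ y≈0 → x≉0 (trans x≈y y≈0)) (trans (*-congˡ (sym x≈y)) (⁻¹-inverseˡ x x≉0))

  ⁻¹-involutive : ∀ {x} → x ≉ 0# → x ⁻¹ ⁻¹ ≈ x
  ⁻¹-involutive {x} x≉0 = sym (⁻¹-unique (⁻¹-nonZero x≉0) (⁻¹-inverseʳ x x≉0))

  ⁻¹-injective : ∀ {x y} → x ≉ 0# → y ≉ 0# → x ⁻¹ ≈ y ⁻¹ → x ≈ y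
  ⁻¹-injective {x} {y} x≉0 y≉0 x⁻¹≈y⁻¹ = begin
    x         ≈⟨ ⁻¹-involutive x≉0 ⟨
    x ⁻¹ ⁻¹   ≈⟨ ⁻¹-cong (⁻¹-nonZero x≉0) x⁻¹≈y⁻¹ ⟩
    y ⁻¹ ⁻¹   ≈⟨ ⁻¹-involutive y≉0 ⟩
    y         ∎

  x⁻¹*[x*y]≈y : ∀ {x} y → x ≉ 0# → x ⁻¹ * (x * y) ≈ y
  x⁻¹*[x*y]≈y {x} y x≉0 = begin
    x ⁻¹ * (x * y) ≈⟨ *-assoc _ x y ⟨
    x ⁻¹ * x * y   ≈⟨ *-congʳ (⁻¹-inverseˡ x x≉0) ⟩
    1# * y         ≈⟨ *-identityˡ y ⟩
    y              ∎

  ^-cong : ∀ {x y} → x ≈ y → ∀ k → x ^ k ≈ y ^ k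
  ^-cong x≈y zero    = refl
  ^-cong x≈y (suc k) = *-cong x≈y (^-cong x≈y k)

  ^-distrib-* : ∀ x y k → (x * y) ^ k ≈ x ^ k * y ^ k
  ^-distrib-* x y zero    = sym (*-identityˡ 1#)
  ^-distrib-* x y (suc k) = begin
    x * y * (x * y) ^ k       ≈⟨ *-congˡ (^-distrib-* x y k) ⟩
    x * y * (x ^ k * y ^ k)   ≈⟨ interchange x y (x ^ k) (y ^ k) ⟩
    x * x ^ k * (y * y ^ k)   ∎

  ^-nonZero : ∀ {x} → x ≉ 0# → ∀ k → x ^ k ≉ 0#
  ^-nonZero x≉0 zero    1≈0 = 0#≉1# (sym 1≈0)
  ^-nonZero x≉0 (suc k)     = *-nonZero x≉0 (^-nonZero x≉0 k)

  root-nonZero : ∀ {x a} m → a ≉ 0# → x ^ suc m ≈ a → x ≉ 0#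
  root-nonZero {x} m a≉0 xⁿ≈a x≈0 = a≉0 (trans (sym xⁿ≈a) (trans (*-congʳ x≈0) (zeroˡ (x ^ m))))

  ⁻¹-^ : ∀ {x} → x ≉ 0# → ∀ k → (x ⁻¹) ^ k ≈ (x ^ k) ⁻¹
  ⁻¹-^ {x} x≉0 k = ⁻¹-unique (^-nonZero x≉0 k) (begin
    x ⁻¹ ^ k * x ^ k ≈⟨ ^-distrib-* (x ⁻¹) x k ⟨
    (x ⁻¹ * x) ^ k   ≈⟨ ^-cong (⁻¹-inverseˡ x x≉0) k ⟩
    1# ^ k           ≈⟨ 1^k≈1 k ⟩
    1#               ∎)
    where
    1^k≈1 : ∀ k → 1# ^ k ≈ 1#
    1^k≈1 zero    = refl
    1^k≈1 (suc k) = trans (*-identityˡ _) (1^k≈1 k)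

  reciprocal-root : ∀ {α a} m → a ≉ 0# → α ^ suc m ≈ a → (α ⁻¹) ^ suc m ≈ a ⁻¹
  reciprocal-root {α} m a≉0 αⁿ≈a = trans (⁻¹-^ α≉0 (suc m)) (⁻¹-cong (^-nonZero α≉0 (suc m)) αⁿ≈a)
    where
    α≉0 : α ≉ 0#
    α≉0 = root-nonZero m a≉0 αⁿ≈a

  sumK-cong : ∀ {F G : Carrier → Carrier} {xs} → All (λ x → F x ≈ G x) xs → sumK (map F xs) ≈ sumK (map G xs)
  sumK-cong []            = refl
  sumK-cong (Fx≈Gx ∷ F≈G) = +-cong Fx≈Gx (sumK-cong F≈G)

  sumK-zero : ∀ {F : Carrier → Carrier} {xs} → All (λ x → F x ≈ 0#) xs → sumK (map F xs) ≈ 0#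
  sumK-zero []           = refl
  sumK-zero (Fx≈0 ∷ F≈0) = trans (+-cong Fx≈0 (sumK-zero F≈0)) (+-identityˡ 0#)

  sumK-*ˡ : ∀ w (F : Carrier → Carrier) xs → sumK (map (λ x → w * F x) xs) ≈ w * sumK (map F xs)
  sumK-*ˡ w F []       = sym (zeroʳ w)
  sumK-*ˡ w F (x ∷ xs) = trans (+-congˡ (sumK-*ˡ w F xs)) (sym (distribˡ w _ _))

  sumK-pick : ∀ (F : Carrier → Carrier) {x v ys} → AllPairs _≉_ ys → Any (x ≈_) ys →
              All (λ y → (x ≈ y → F y ≈ v) × (x ≉ y → F y ≈ 0#)) ys → sumK (map F ys) ≈ v
  sumK-pick F {x} {v} {y ∷ _} (y≉ys ∷ _) (here x≈y) ((hit , _) ∷ rest) =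
    trans (+-cong (hit x≈y) (sumK-zero (All.zipWith miss (y≉ys , rest)))) (+-identityʳ _)
    where
    miss : ∀ {z} → y ≉ z × ((x ≈ z → F z ≈ v) × (x ≉ z → F z ≈ 0#)) → F z ≈ 0#
    miss (y≉z , (_ , off)) = off (λ x≈z → y≉z (trans (sym x≈y) x≈z))
  sumK-pick F {x} {ys = y ∷ _} (y≉ys ∷ distinct) (there x∈ys) ((_ , off) ∷ rest) =
    trans (+-cong (off x≉y) (sumK-pick F distinct x∈ys rest)) (+-identityˡ _)
    where
    x≉y : x ≉ y
    x≉y x≈y with All.lookupAny y≉ys x∈ys
    ... | y≉z , x≈z = y≉z (trans (sym x≈y) x≈z)

module PolynomialProperties {c ℓ : Level} (K : Field c ℓ) where
  open Field K
  open FieldTheory K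
  open FieldProperties K
  open import Algebra.Properties.Ring ring using (+-cancelˡ)
  open import Algebra.Properties.CommutativeSemigroup *-commutativeSemigroup using (x∙yz≈y∙xz)
  open import Relation.Binary.Reasoning.Setoid setoid
  open import Tactic.RingSolver.NonReflective (fromCommutativeRing commutativeRing (λ _ → nothing))

  infixr 7 _·ₚ_
  _·ₚ_ : Carrier → Poly → Poly
  s ·ₚ p = map (s *_) p

  sumₚ : List Poly → Poly
  sumₚ = foldr _+ₚ_ []

  monomial : ℕ → Poly
  monomial k = replicate k 0# ++ (1# ∷ [])

  eval-zero : ∀ p y → (∀ k → coeff p k ≈ 0#) → eval p y ≈ 0#
  eval-zero []      y p≈0 = refl
  eval-zero (a ∷ p) y p≈0 = begin
    a + y * eval p y ≈⟨ +-cong (p≈0 0) (*-congˡ (eval-zero p y (p≈0 ∘ suc))) ⟩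
    0# + y * 0#      ≈⟨ +-identityˡ _ ⟩
    y * 0#           ≈⟨ zeroʳ y ⟩
    0#               ∎

  eval-≈ₚ : ∀ p q y → p ≈ₚ q → eval p y ≈ eval q y
  eval-≈ₚ []      []      y p≈q = refl
  eval-≈ₚ []      (b ∷ q) y p≈q = sym (eval-zero (b ∷ q) y (sym ∘ p≈q))
  eval-≈ₚ (a ∷ p) []      y p≈q = eval-zero (a ∷ p) y p≈q
  eval-≈ₚ (a ∷ p) (b ∷ q) y p≈q = +-cong (p≈q 0) (*-congˡ (eval-≈ₚ p q y (p≈q ∘ suc)))

  eval-cong : ∀ p {x y} → x ≈ y → eval p x ≈ eval p y
  eval-cong []      x≈y = refl
  eval-cong (a ∷ p) x≈y = +-congˡ (*-cong x≈y (eval-cong p x≈y))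

  eval-0 : ∀ p → eval p 0# ≈ coeff p 0
  eval-0 []      = refl
  eval-0 (a ∷ p) = trans (+-congˡ (zeroˡ _)) (+-identityʳ a)

  eval-const : ∀ u y → eval (constₚ u) y ≈ u
  eval-const u y = trans (+-congˡ (zeroʳ y)) (+-identityʳ u)

  eval-+ₚ : ∀ p q y → eval (p +ₚ q) y ≈ eval p y + eval q y
  eval-+ₚ []      q       y = sym (+-identityˡ _)
  eval-+ₚ (a ∷ p) []      y = sym (+-identityʳ _)
  eval-+ₚ (a ∷ p) (b ∷ q) y = begin
    a + b + y * eval (p +ₚ q) y             ≈⟨ +-congˡ (*-congˡ (eval-+ₚ p q y)) ⟩
    a + b + y * (eval p y + eval q y)       ≈⟨ solve 5 (λ a b y P Q → (a ⊕ b ⊕ y ⊗ (P ⊕ Q)) ⊜ ((a ⊕ y ⊗ P) ⊕ (b ⊕ y ⊗ Q))) refl a b y (eval p y) (eval q y) ⟩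
    a + y * eval p y + (b + y * eval q y)   ∎

  eval-·ₚ : ∀ s q y → eval (s ·ₚ q) y ≈ s * eval q y
  eval-·ₚ s []      y = sym (zeroʳ s)
  eval-·ₚ s (b ∷ q) y = begin
    s * b + y * eval (s ·ₚ q) y ≈⟨ +-congˡ (*-congˡ (eval-·ₚ s q y)) ⟩
    s * b + y * (s * eval q y)  ≈⟨ solve 4 (λ s b y Q → (s ⊗ b ⊕ y ⊗ (s ⊗ Q)) ⊜ (s ⊗ (b ⊕ y ⊗ Q))) refl s b y (eval q y) ⟩
    s * (b + y * eval q y)      ∎

  eval-*ₚ : ∀ p q y → eval (p *ₚ q) y ≈ eval p y * eval q y
  eval-*ₚ []      q y = sym (zeroˡ _)
  eval-*ₚ (a ∷ p) q y = begin
    eval (a ·ₚ q +ₚ (0# ∷ p *ₚ q)) y              ≈⟨ eval-+ₚ (a ·ₚ q) (0# ∷ p *ₚ q) y ⟩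
    eval (a ·ₚ q) y + (0# + y * eval (p *ₚ q) y)  ≈⟨ +-cong (eval-·ₚ a q y) (+-identityˡ _) ⟩
    a * eval q y + y * eval (p *ₚ q) y            ≈⟨ +-congˡ (*-congˡ (eval-*ₚ p q y)) ⟩
    a * eval q y + y * (eval p y * eval q y)      ≈⟨ solve 4 (λ a Q y P → (a ⊗ Q ⊕ y ⊗ (P ⊗ Q)) ⊜ ((a ⊕ y ⊗ P) ⊗ Q)) refl a (eval q y) y (eval p y) ⟩
    (a + y * eval p y) * eval q y                 ∎

  eval-shift : ∀ k r y → eval (replicate k 0# ++ r) y ≈ y ^ k * eval r y
  eval-shift zero    r y = sym (*-identityˡ _)
  eval-shift (suc k) r y = begin
    0# + y * eval (replicate k 0# ++ r) y ≈⟨ +-identityˡ _ ⟩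
    y * eval (replicate k 0# ++ r) y      ≈⟨ *-congˡ (eval-shift k r y) ⟩
    y * (y ^ k * eval r y)                ≈⟨ *-assoc y _ _ ⟨
    y * y ^ k * eval r y                  ∎

  eval-monomial : ∀ k y → eval (monomial k) y ≈ y ^ k
  eval-monomial k y = trans (eval-shift k (constₚ 1#) y) (trans (*-congˡ (eval-const 1# y)) (*-identityʳ _))

  eval-sumₚ : ∀ (T : Carrier → Poly) xs y → eval (sumₚ (map T xs)) y ≈ sumK (map (λ x → eval (T x) y) xs)
  eval-sumₚ T []       y = refl
  eval-sumₚ T (x ∷ xs) y = trans (eval-+ₚ (T x) (sumₚ (map T xs)) y) (+-congˡ (eval-sumₚ T xs y))

  coeff-+ₚ : ∀ p q k → coeff (p +ₚ q) k ≈ coeff p k + coeff q k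
  coeff-+ₚ []      q       k       = sym (+-identityˡ _)
  coeff-+ₚ (a ∷ p) []      k       = sym (+-identityʳ _)
  coeff-+ₚ (a ∷ p) (b ∷ q) zero    = refl
  coeff-+ₚ (a ∷ p) (b ∷ q) (suc k) = coeff-+ₚ p q k

  coeff-·ₚ : ∀ s q k → coeff (s ·ₚ q) k ≈ s * coeff q k
  coeff-·ₚ s []      k       = sym (zeroʳ s)
  coeff-·ₚ s (b ∷ q) zero    = refl
  coeff-·ₚ s (b ∷ q) (suc k) = coeff-·ₚ s q k

  DegLessThan-+ₚ : ∀ p q {n} → DegLessThan p n → DegLessThan q n → DegLessThan (p +ₚ q) n
  DegLessThan-+ₚ p q deg-p deg-q j n≤j =
    trans (coeff-+ₚ p q j) (trans (+-cong (deg-p j n≤j) (deg-q j n≤j)) (+-identityˡ 0#))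

  DegLessThan-·ₚ : ∀ s q {n} → DegLessThan q n → DegLessThan (s ·ₚ q) n
  DegLessThan-·ₚ s q deg-q j n≤j = trans (coeff-·ₚ s q j) (trans (*-congˡ (deg-q j n≤j)) (zeroʳ s))

  DegLessThan-sumₚ : ∀ {n} (T : Carrier → Poly) xs → (∀ x → DegLessThan (T x) n) → DegLessThan (sumₚ (map T xs)) n
  DegLessThan-sumₚ T []       deg-T j _ = refl
  DegLessThan-sumₚ T (x ∷ xs) deg-T     = DegLessThan-+ₚ (T x) _ (deg-T x) (DegLessThan-sumₚ T xs deg-T)

  monomial-degree : ∀ k → DegLessThan (monomial k) (suc k)
  monomial-degree zero    (suc j) _         = refl
  monomial-degree (suc k) (suc j) (s≤s k<j) = monomial-degree k j k<j

  -- Synthetic division by w - x:  (w - x) · deflate x p = p - p(x).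
  deflate : Carrier → Poly → Poly
  deflate x []      = []
  deflate x (_ ∷ p) = eval p x ∷ deflate x p

  eval-deflate : ∀ x p y → eval p y + x * eval (deflate x p) y ≈ eval p x + y * eval (deflate x p) y
  eval-deflate x []      y = +-congˡ (trans (zeroʳ x) (sym (zeroʳ y)))
  eval-deflate x (a ∷ p) y = begin
    a + y * P + x * (E + y * Q) ≈⟨ solve 6 (λ a y P x E Q → (a ⊕ y ⊗ P ⊕ x ⊗ (E ⊕ y ⊗ Q)) ⊜ (a ⊕ x ⊗ E ⊕ y ⊗ (P ⊕ x ⊗ Q))) refl a y P x E Q ⟩
    a + x * E + y * (P + x * Q) ≈⟨ +-congˡ (*-congˡ (eval-deflate x p y)) ⟩
    a + x * E + y * (E + y * Q) ∎
    where
    P = eval p y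
    E = eval p x
    Q = eval (deflate x p) y

  deflate-root : ∀ {x y} p → eval p x ≈ 0# → eval p y ≈ 0# → x ≉ y → eval (deflate x p) y ≈ 0#
  deflate-root {x} {y} p px≈0 py≈0 x≉y = uq≈vq∧u≉v⇒q≈0 (begin
    x * Q            ≈⟨ +-identityˡ _ ⟨
    0# + x * Q       ≈⟨ +-congʳ py≈0 ⟨
    eval p y + x * Q ≈⟨ eval-deflate x p y ⟩
    eval p x + y * Q ≈⟨ +-congʳ px≈0 ⟩
    0# + y * Q       ≈⟨ +-identityˡ _ ⟩
    y * Q            ∎) x≉y
    where Q = eval (deflate x p) y

  deflate-top : ∀ x p k → DegLessThan p (suc k) → coeff (deflate x p) k ≈ 0#
  deflate-top x []      k       _     = refl
  deflate-top x (a ∷ p) zero    deg-p = eval-zero p x (λ j → deg-p (suc j) (s≤s z≤n))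
  deflate-top x (a ∷ p) (suc k) deg-p = deflate-top x p k (λ j k<j → deg-p (suc j) (s≤s k<j))

  deflate-degree : ∀ x p {k} → DegLessThan p (suc k) → DegLessThan (deflate x p) k
  deflate-degree x p deg-p j k≤j = deflate-top x p j (λ i j<i → deg-p i (≤-trans (s≤s k≤j) j<i))

  deflate-zero⇒zero : ∀ x p → (∀ k → coeff (deflate x p) k ≈ 0#) → eval p x ≈ 0# → ∀ k → coeff p k ≈ 0#
  deflate-zero⇒zero x []      _   _    k       = refl
  deflate-zero⇒zero x (a ∷ p) q≈0 px≈0 zero    = begin
    a                 ≈⟨ +-identityʳ a ⟨
    a + 0#            ≈⟨ +-congˡ (trans (*-congˡ (q≈0 0)) (zeroʳ x)) ⟨
    a + x * eval p x  ≈⟨ px≈0 ⟩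
    0#                ∎
  deflate-zero⇒zero x (a ∷ p) q≈0 px≈0 (suc k) = deflate-zero⇒zero x p (q≈0 ∘ suc) (q≈0 0) k

  vanishing-on-distinct⇒zero : ∀ xs → AllPairs _≉_ xs → ∀ p → DegLessThan p (length xs) →
                               All (λ x → eval p x ≈ 0#) xs → ∀ k → coeff p k ≈ 0#
  vanishing-on-distinct⇒zero []       _                 p deg-p _            k = deg-p k z≤n
  vanishing-on-distinct⇒zero (x ∷ xs) (x≉xs ∷ distinct) p deg-p (px≈0 ∷ p≈0) =
    deflate-zero⇒zero x p
      (vanishing-on-distinct⇒zero xs distinct (deflate x p) (deflate-degree x p deg-p)
        (All.zipWith (λ (x≉y , py≈0) → deflate-root p px≈0 py≈0 x≉y) (x≉xs , p≈0)))
      px≈0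

  -- geom β k = (wᵏ - βᵏ) / (w - β)
  geom : Carrier → ℕ → Poly
  geom β k = deflate β (monomial k)

  geom-degree : ∀ β k → DegLessThan (geom β k) k
  geom-degree β k = deflate-degree β (monomial k) (monomial-degree k)

  geom-root : ∀ {β y} k → y ^ k ≈ β ^ k → y ≉ β → eval (geom β k) y ≈ 0#
  geom-root {β} {y} k yᵏ≈βᵏ y≉β = uq≈vq∧u≉v⇒q≈0 (sym (+-cancelˡ _ _ _ (begin
    eval (monomial k) β + β * G ≈⟨ +-congʳ (trans (eval-monomial k β) (trans (sym yᵏ≈βᵏ) (sym (eval-monomial k y)))) ⟩
    eval (monomial k) y + β * G ≈⟨ eval-deflate β (monomial k) y ⟩
    eval (monomial k) β + y * G ∎))) y≉β
    where G = eval (geom β k) y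

  geom-diagonal : ∀ β k → β * eval (geom β k) β ≈ ι k * β ^ k
  geom-diagonal β zero    = trans (*-congˡ (trans (+-identityˡ _) (zeroʳ β))) (trans (zeroʳ β) (sym (zeroˡ 1#)))
  geom-diagonal β (suc k) = begin
    β * (eval (monomial k) β + β * eval (geom β k) β) ≈⟨ *-congˡ (+-cong (eval-monomial k β) (geom-diagonal β k)) ⟩
    β * (β ^ k + ι k * β ^ k)                         ≈⟨ distribˡ β _ _ ⟩
    β * β ^ k + β * (ι k * β ^ k)                     ≈⟨ +-cong (sym (*-identityˡ _)) (x∙yz≈y∙xz β (ι k) (β ^ k)) ⟩
    1# * (β * β ^ k) + ι k * (β * β ^ k)              ≈⟨ distribʳ _ 1# (ι k) ⟨
    (1# + ι k) * (β * β ^ k)                          ∎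

  geom-at-0 : ∀ β k → eval (geom β (suc k)) 0# ≈ β ^ k
  geom-at-0 β k = trans (eval-0 (geom β (suc k))) (eval-monomial k β)

module MeansOverNthRoots {c ℓ : Level} (K : Field c ℓ) where
  open Field K
  open FieldTheory K
  open FieldProperties K
  open PolynomialProperties K
  open import Algebra.Properties.Ring ring using (-‿distribˡ-*; x∙y⁻¹≈ε⇒x≈y; x≈y⇒x∙y⁻¹≈ε)
  open import Algebra.Properties.CommutativeSemigroup *-commutativeSemigroup using (xy∙z≈y∙xz)
  open import Relation.Binary.Reasoning.Setoid setoid

  DistinctRoots : ℕ → Carrier → List Carrier → Set (c ⊔ ℓ)
  DistinctRoots n γ xs = AllPairs _≉_ xs × All (λ x → x ^ n ≈ γ) xs

  AllRootsOf : ℕ → Carrier → List Carrier → Set (c ⊔ ℓ)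
  AllRootsOf n γ xs = DistinctRoots n γ xs × (∀ x → x ^ n ≈ γ → Any (x ≈_) xs)

  scaled-roots : ∀ {n β γ ζs} → β ≉ 0# → β ^ n ≈ γ → DistinctRoots n 1# ζs → DistinctRoots n γ (map (β *_) ζs)
  scaled-roots {n} {β} {γ} β≉0 βⁿ≈γ (distinct , roots) =
    AllPairsP.map⁺ (AllPairs.map (λ ζ≉ζ′ → ζ≉ζ′ ∘ *-cancelˡ-nonZero β≉0) distinct) ,
    AllP.map⁺ (All.map root roots)
    where
    root : ∀ {ζ} → ζ ^ n ≈ 1# → (β * ζ) ^ n ≈ γ
    root {ζ} ζⁿ≈1 = begin
      (β * ζ) ^ n   ≈⟨ ^-distrib-* β ζ n ⟩
      β ^ n * ζ ^ n ≈⟨ *-cong βⁿ≈γ ζⁿ≈1 ⟩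
      γ * 1#        ≈⟨ *-identityʳ γ ⟩
      γ             ∎

  ⁻¹-distinct : ∀ {xs} → All (_≉ 0#) xs → AllPairs _≉_ xs → AllPairs _≉_ (map _⁻¹ xs)
  ⁻¹-distinct []              []                = []
  ⁻¹-distinct (x≉0 ∷ nonZero) (x≉xs ∷ distinct) =
    AllP.map⁺ (All.zipWith (λ (y≉0 , x≉y) → x≉y ∘ ⁻¹-injective x≉0 y≉0) (nonZero , x≉xs)) ∷
    ⁻¹-distinct nonZero distinct

  reciprocal-roots : ∀ m {γ αs} → γ ≉ 0# → AllRootsOf (suc m) γ αs → AllRootsOf (suc m) (γ ⁻¹) (map _⁻¹ αs)
  reciprocal-roots m {γ} {αs} γ≉0 ((distinct , roots) , complete) =
    (⁻¹-distinct (All.map (root-nonZero m γ≉0) roots) distinct , AllP.map⁺ (All.map (reciprocal-root m γ≉0) roots)) ,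
    complete′
    where
    complete′ : ∀ δ → δ ^ suc m ≈ γ ⁻¹ → Any (δ ≈_) (map _⁻¹ αs)
    complete′ δ δⁿ≈γ⁻¹ = AnyP.map⁺ (Any.map δ≈α⁻¹ (complete (δ ⁻¹) δ⁻¹ⁿ≈γ))
      where
      δ≉0 : δ ≉ 0#
      δ≉0 = root-nonZero m (⁻¹-nonZero γ≉0) δⁿ≈γ⁻¹
      δ⁻¹ⁿ≈γ : (δ ⁻¹) ^ suc m ≈ γ
      δ⁻¹ⁿ≈γ = trans (reciprocal-root m (⁻¹-nonZero γ≉0) δⁿ≈γ⁻¹) (⁻¹-involutive γ≉0)
      δ≈α⁻¹ : ∀ {α} → δ ⁻¹ ≈ α → δ ≈ α ⁻¹
      δ≈α⁻¹ δ⁻¹≈α = trans (sym (⁻¹-involutive δ≉0)) (⁻¹-cong (⁻¹-nonZero δ≉0) δ⁻¹≈α)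

  -- n γ times the Lagrange interpolant of A at the roots βs of wⁿ = γ.
  interpolant : ℕ → List Carrier → Poly → Poly
  interpolant n βs A = sumₚ (map (λ β → (β * eval A β) ·ₚ geom β n) βs)

  interpolant-degree : ∀ n βs A → DegLessThan (interpolant n βs A) n
  interpolant-degree n βs A = DegLessThan-sumₚ _ βs (λ β → DegLessThan-·ₚ (β * eval A β) (geom β n) (geom-degree β n))

  interpolant-at-root : ∀ {n γ βs} A → AllRootsOf n γ βs → ∀ {δ} → δ ^ n ≈ γ →
                        eval (interpolant n βs A) δ ≈ ι n * γ * eval A δ
  interpolant-at-root {n} {γ} {βs} A ((distinct , roots) , complete) {δ} δⁿ≈γ = begin
    eval (interpolant n βs A) δ        ≈⟨ eval-sumₚ term βs δ ⟩
    sumK (map (λ β → eval (term β) δ) βs) ≈⟨ sumK-pick (λ β → eval (term β) δ) distinct (complete δ δⁿ≈γ) (All.map (λ βⁿ≈γ → hit βⁿ≈γ , miss βⁿ≈γ) roots) ⟩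
    ι n * γ * eval A δ                  ∎
    where
    term : Carrier → Poly
    term β = (β * eval A β) ·ₚ geom β n
    hit : ∀ {β} → β ^ n ≈ γ → δ ≈ β → eval (term β) δ ≈ ι n * γ * eval A δ
    hit {β} βⁿ≈γ δ≈β = begin
      eval (term β) δ                        ≈⟨ eval-·ₚ _ (geom β n) δ ⟩
      β * eval A β * eval (geom β n) δ       ≈⟨ *-congˡ (eval-cong (geom β n) δ≈β) ⟩
      β * eval A β * eval (geom β n) β       ≈⟨ xy∙z≈y∙xz β (eval A β) _ ⟩
      eval A β * (β * eval (geom β n) β)     ≈⟨ *-congˡ (trans (geom-diagonal β n) (*-congˡ βⁿ≈γ)) ⟩
      eval A β * (ι n * γ)                   ≈⟨ *-comm _ _ ⟩
      ι n * γ * eval A β                     ≈⟨ *-congˡ (eval-cong A δ≈β) ⟨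
      ι n * γ * eval A δ                     ∎
    miss : ∀ {β} → β ^ n ≈ γ → δ ≉ β → eval (term β) δ ≈ 0#
    miss {β} βⁿ≈γ δ≉β = begin
      eval (term β) δ                  ≈⟨ eval-·ₚ _ (geom β n) δ ⟩
      β * eval A β * eval (geom β n) δ ≈⟨ *-congˡ (geom-root n (trans δⁿ≈γ (sym βⁿ≈γ)) δ≉β) ⟩
      β * eval A β * 0#                ≈⟨ zeroʳ _ ⟩
      0#                               ∎

  interpolant-at-0 : ∀ m {γ βs} A → All (λ β → β ^ suc m ≈ γ) βs →
                     eval (interpolant (suc m) βs A) 0# ≈ γ * sumK (map (eval A) βs)
  interpolant-at-0 m {γ} {βs} A roots = begin
    eval (interpolant (suc m) βs A) 0#     ≈⟨ eval-sumₚ term βs 0# ⟩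
    sumK (map (λ β → eval (term β) 0#) βs) ≈⟨ sumK-cong (All.map constant-term roots) ⟩
    sumK (map (λ β → γ * eval A β) βs)     ≈⟨ sumK-*ˡ γ (eval A) βs ⟩
    γ * sumK (map (eval A) βs)             ∎
    where
    term : Carrier → Poly
    term β = (β * eval A β) ·ₚ geom β (suc m)
    constant-term : ∀ {β} → β ^ suc m ≈ γ → eval (term β) 0# ≈ γ * eval A β
    constant-term {β} βⁿ≈γ = begin
      eval (term β) 0#                         ≈⟨ eval-·ₚ _ (geom β (suc m)) 0# ⟩
      β * eval A β * eval (geom β (suc m)) 0#  ≈⟨ *-congˡ (geom-at-0 β m) ⟩
      β * eval A β * β ^ m                     ≈⟨ xy∙z≈y∙xz β (eval A β) (β ^ m) ⟩
      eval A β * (β * β ^ m)                   ≈⟨ *-congˡ βⁿ≈γ ⟩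
      eval A β * γ                             ≈⟨ *-comm _ _ ⟩
      γ * eval A β                             ∎

  -- βs need not be known to have n elements; the n distinct roots ds are the points at which
  -- the degree < n polynomial interpolant - n γ A is seen to vanish.
  mean-over-roots : ∀ m {γ} → γ ≉ 0# → ∀ {ds} → length ds ≡ suc m → DistinctRoots (suc m) γ ds →
                    ∀ {βs} → AllRootsOf (suc m) γ βs → ∀ A → DegLessThan A (suc m) →
                    sumK (map (eval A) βs) ≈ ι (suc m) * coeff A 0
  mean-over-roots m {γ} γ≉0 {ds} length-ds (ds-distinct , ds-roots) {βs} βs-roots A deg-A =
    *-cancelˡ-nonZero γ≉0 (begin
      γ * sumK (map (eval A) βs)   ≈⟨ interpolant-at-0 m A (proj₂ (proj₁ βs-roots)) ⟨
      eval L 0#                    ≈⟨ x∙y⁻¹≈ε⇒x≈y _ _ (trans (sym (eval-P 0#)) P-at-0) ⟩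
      ι n * γ * eval A 0#          ≈⟨ *-congʳ (*-comm (ι n) γ) ⟩
      γ * ι n * eval A 0#          ≈⟨ *-assoc γ (ι n) _ ⟩
      γ * (ι n * eval A 0#)        ≈⟨ *-congˡ (*-congˡ (eval-0 A)) ⟩
      γ * (ι n * coeff A 0)        ∎)
    where
    n = suc m
    L = interpolant n βs A
    P = L +ₚ (- (ι n * γ)) ·ₚ A

    eval-P : ∀ x → eval P x ≈ eval L x - ι n * γ * eval A x
    eval-P x = trans (eval-+ₚ L _ x) (+-congˡ (trans (eval-·ₚ _ A x) (sym (-‿distribˡ-* _ _))))

    P-degree : DegLessThan P (length ds)
    P-degree = ≡.subst (DegLessThan P) (≡.sym length-ds)
      (DegLessThan-+ₚ L _ (interpolant-degree n βs A) (DegLessThan-·ₚ _ A deg-A))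

    P-vanishes : All (λ δ → eval P δ ≈ 0#) ds
    P-vanishes = All.map (λ δⁿ≈γ → trans (eval-P _) (x≈y⇒x∙y⁻¹≈ε (interpolant-at-root {n} A βs-roots δⁿ≈γ))) ds-roots

    P-at-0 : eval P 0# ≈ 0#
    P-at-0 = trans (eval-0 P) (vanishing-on-distinct⇒zero ds ds-distinct P P-degree P-vanishes 0)

  oneMinus-root : ∀ {a n y} → a ≉ 0# → y ^ n ≈ a ⁻¹ → eval (oneMinus a n) y ≈ 0#
  oneMinus-root {a} {n} {y} a≉0 yⁿ≈a⁻¹ = begin
    eval (oneMinus a n) y                  ≈⟨ eval-+ₚ (constₚ 1#) (replicate n 0# ++ constₚ (- a)) y ⟩
    eval (constₚ 1#) y + eval (replicate n 0# ++ constₚ (- a)) y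
                                           ≈⟨ +-cong (eval-const 1# y) (eval-shift n (constₚ (- a)) y) ⟩
    1# + y ^ n * eval (constₚ (- a)) y     ≈⟨ +-congˡ (*-cong yⁿ≈a⁻¹ (eval-const (- a) y)) ⟩
    1# + a ⁻¹ * - a                        ≈⟨ +-congˡ (trans (*-comm _ _) (sym (-‿distribˡ-* a _))) ⟩
    1# - a * a ⁻¹                          ≈⟨ +-congˡ (-‿cong (⁻¹-inverseʳ a a≉0)) ⟩
    1# - 1#                                ≈⟨ -‿inverseʳ 1# ⟩
    0#                                     ∎

  partialFraction-at-root : ∀ A B f g {y} → A *ₚ f +ₚ B *ₚ g ≈ₚ constₚ 1# → eval g y ≈ 0# →
                            eval f y ⁻¹ ≈ eval A y
  partialFraction-at-root A B f g {y} decomposition gy≈0 =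
    sym (⁻¹-unique (λ fy≈0 → 0#≉1# (trans (sym (trans (*-congˡ fy≈0) (zeroʳ _))) Af≈1)) Af≈1)
    where
    Af≈1 : eval A y * eval f y ≈ 1#
    Af≈1 = begin
      eval A y * eval f y                              ≈⟨ +-identityʳ _ ⟨
      eval A y * eval f y + 0#                         ≈⟨ +-congˡ (trans (*-congˡ gy≈0) (zeroʳ _)) ⟨
      eval A y * eval f y + eval B y * eval g y        ≈⟨ +-cong (eval-*ₚ A f y) (eval-*ₚ B g y) ⟨
      eval (A *ₚ f) y + eval (B *ₚ g) y                ≈⟨ eval-+ₚ (A *ₚ f) (B *ₚ g) y ⟨
      eval (A *ₚ f +ₚ B *ₚ g) y                        ≈⟨ eval-≈ₚ (A *ₚ f +ₚ B *ₚ g) (constₚ 1#) y decomposition ⟩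
      eval (constₚ 1#) y                               ≈⟨ eval-const 1# y ⟩
      1#                                               ∎

lemma3p4 : {c ℓ : Level} (K : Field c ℓ) → let open Field K in let open FieldTheory K in
    (n : ℕ) → NonZero n → CharNotDividing n → ContainsRootsOfUnity n →
    (a : Carrier) → ¬ (a ≈ 0#) → Σ Carrier (λ b → ¬ (b ≈ 0#) × b ^ n ≈ a) →
    (f : Poly) → Coprime f (oneMinus a n) →
    (A B : Poly) → DegLessThan A n → DegLess B f →
    A *ₚ f +ₚ B *ₚ oneMinus a n ≈ₚ constₚ 1# →
    (roots : List Carrier) → AllPairs (λ x y → ¬ (x ≈ y)) roots →
    All (λ α → α ^ n ≈ a) roots → (∀ α → α ^ n ≈ a → Any (α ≈_) roots) →
    coeff A 0 ≈ ι n ⁻¹ * sumK (map (λ α → eval f (α ⁻¹) ⁻¹) roots)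
lemma3p4 K zero ()
-- Coprimality and deg B < deg f only make the decomposition unique; any A with deg A < n works.
lemma3p4 K n@(suc m) _ ι≉0 (ζs , length-ζs , unity-roots) a a≉0 (b , b≉0 , bⁿ≈a) f _ A B deg-A _ decomposition
         αs αs-distinct αs-roots αs-complete = begin
  coeff A 0                                     ≈⟨ x⁻¹*[x*y]≈y _ ι≉0 ⟨
  ι n ⁻¹ * (ι n * coeff A 0)                    ≈⟨ *-congˡ mean ⟨
  ι n ⁻¹ * sumK (map (eval A) (map _⁻¹ αs))     ≡⟨ ≡.cong (λ xs → ι n ⁻¹ * sumK xs) (map-∘ αs) ⟨
  ι n ⁻¹ * sumK (map (λ α → eval A (α ⁻¹)) αs)  ≈⟨ *-congˡ (sumK-cong (All.map (λ αⁿ≈a → sym (reciprocal-value αⁿ≈a)) αs-roots)) ⟩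
  ι n ⁻¹ * sumK (map (λ α → eval f (α ⁻¹) ⁻¹) αs) ∎
  where
  open Field K
  open FieldTheory K
  open FieldProperties K
  open PolynomialProperties K
  open MeansOverNthRoots K
  open import Relation.Binary.Reasoning.Setoid setoid

  reciprocal-value : ∀ {α} → α ^ n ≈ a → eval f (α ⁻¹) ⁻¹ ≈ eval A (α ⁻¹)
  reciprocal-value αⁿ≈a = partialFraction-at-root A B f (oneMinus a n) decomposition
    (oneMinus-root {n = n} a≉0 (reciprocal-root m a≉0 αⁿ≈a))

  mean : sumK (map (eval A) (map _⁻¹ αs)) ≈ ι n * coeff A 0
  mean = mean-over-roots m (⁻¹-nonZero a≉0) (≡.trans (length-map _ ζs) length-ζs)
    (scaled-roots {n} (⁻¹-nonZero b≉0) (reciprocal-root m a≉0 bⁿ≈a) unity-roots)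
    (reciprocal-roots m a≉0 ((αs-distinct , αs-roots) , αs-complete)) A deg-A
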